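{- Let $G_0$ be a connected bipartite $(p,q)$-graph admitting an odd-edge edge-magic total coloring $h_0$. Then for every positive integer $n$ there is a sequence $G_0,G_1,\dots,G_n$ of connected bipartite graphs such that for each $k\in[1,n]$ the graph $G_k$ is obtained from $G_{k-1}$ by adding $a_k\geq 1$ leaves and admits an odd-edge edge-magic total coloring $h_k$, and moreover $h_i(V(G_i))\cap h_j(V(G_j))\neq\emptyset$ for all $i,j\in[0,n]$.
   Context: A $(p,q)$-graph has $p$ vertices and $q$ edges; $[a,b]=\{a,\dots,b\}$ and $[1,2q-1]^o$ denotes the set of odd integers in $[1,2q-1]$; $h(S)=\{h(s):s\in S\}$. Adding a leaf to a graph $H$ means adding a new vertex $w$ and an edge $xw$ for some $x\in V(H)$. For a bipartite $(p,q)$-graph $H$ with $q\ge1$, an odd-edge edge-magic total coloring is a map $h:V(H)\cup E(H)\to[0,2q-1]$ (vertex colors need not be distinct) such that $h(E(H))=[1,2q-1]^o$ and there is a positive integer $k$ with $h(u)+h(uv)+h(v)=k$ for every edge $uv\in E(H)$. -}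

module Defs where

open import Data.Nat using (ℕ; zero; suc; _+_; _*_; _∸_; _≤_; _<_)
open import Data.Fin using (Fin; zero; suc; _↑ˡ_; _↑ʳ_; splitAt)
open import Data.Bool using (Bool)
open import Data.Product using (Σ; _×_; _,_; proj₁; proj₂)
open import Data.Sum using (_⊎_; [_,_])
open import Relation.Binary.PropositionalEquality using (_≡_; _≢_)

record Graph : Set where
  constructor mkGraph
  field
    p    : ℕ
    q    : ℕ
    ends : Fin q → Fin p × Fin p

open Graph public

SameEdge : {p : ℕ} → Fin p × Fin p → Fin p × Fin p → Set
SameEdge (a , b) (c , d) = (a ≡ c × b ≡ d) ⊎ (a ≡ d × b ≡ c)

Simple : Graph → Set
Simple G = (∀ e → proj₁ (ends G e) ≢ proj₂ (ends G e))
         × (∀ e e′ → SameEdge (ends G e) (ends G e′) → e ≡ e′)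

Adjacent : (G : Graph) → Fin (p G) → Fin (p G) → Set
Adjacent G u v = Σ (Fin (q G)) λ e → SameEdge (ends G e) (u , v)

data Reach (G : Graph) (u : Fin (p G)) : Fin (p G) → Set where
  here : Reach G u u
  step : ∀ {v w} → Reach G u v → Adjacent G v w → Reach G u w

Connected : Graph → Set
Connected G = ∀ u v → Reach G u v

Bipartite : Graph → Set
Bipartite G = Σ (Fin (p G) → Bool) λ c →
  ∀ e → c (proj₁ (ends G e)) ≢ c (proj₂ (ends G e))

Odd : ℕ → Set
Odd m = Σ ℕ λ t → m ≡ suc (2 * t)

-- odd-edge edge-magic total coloring of G (G assumed bipartite with q ≥ 1)
record OEEMTC (G : Graph) : Set where
  field
    q≥1    : 1 ≤ q G
    hv     : Fin (p G) → ℕ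
    he     : Fin (q G) → ℕ
    hv-rng : ∀ v → hv v ≤ 2 * q G ∸ 1
    he-odd : ∀ e → Odd (he e) × he e ≤ 2 * q G ∸ 1
    he-onto : ∀ m → Odd m → m ≤ 2 * q G ∸ 1 → Σ (Fin (q G)) λ e → he e ≡ m
    magic  : Σ ℕ λ k → 1 ≤ k ×
               (∀ e → hv (proj₁ (ends G e)) + he e + hv (proj₂ (ends G e)) ≡ k)

open OEEMTC public

-- add a new leaves w_0..w_{a-1} to G, w_i adjacent to the old vertex f i
addLeaves : (G : Graph) (a : ℕ) → (Fin a → Fin (p G)) → Graph
addLeaves G a f = mkGraph (p G + a) (q G + a)
  (λ e → [ (λ e′ → (proj₁ (ends G e′) ↑ˡ a) , (proj₂ (ends G e′) ↑ˡ a))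
         , (λ i → (f i ↑ˡ a) , (p G ↑ʳ i)) ] (splitAt (q G) e))

AddsLeaves : Graph → Graph → Set
AddsLeaves G H = Σ ℕ λ a → 1 ≤ a × Σ (Fin a → Fin (p G)) λ f → H ≡ addLeaves G a f

-- the sequence G_0, G_1, …, G_n  with G_{k+1} = Gs k
seqG : ∀ {n} → Graph → (Fin n → Graph) → Fin (suc n) → Graph
seqG G0 Gs zero    = G0
seqG G0 Gs (suc k) = Gs k

VColor : ∀ {n} (G0 : Graph) (h0 : OEEMTC G0) (Gs : Fin n → Graph)
         (hs : (k : Fin n) → OEEMTC (Gs k)) → Fin (suc n) → ℕ → Set
VColor G0 h0 Gs hs zero    m = Σ (Fin (p G0)) λ v → hv h0 v ≡ m
VColor G0 h0 Gs hs (suc k) m = Σ (Fin (p (Gs k))) λ v → hv (hs k) v ≡ m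

{-# OPTIONS --safe #-}

-- Let e₁ = xy be the edge of colour 1 and hang a single new leaf w on x.  Raising every
-- old edge colour by 2, colouring xw with 1 and w with h(y) + 2 is again an odd-edge
-- edge-magic total colouring, with magic constant k + 2: on old edges the sum rises by 2,
-- and on xw it is h(x) + 1 + h(y) + 2 = h(x) + h(e₁) + h(y) + 2.  Old vertices keep their
-- colours, so iterating from G₀ gives the sequence, and the colour of x in G₀ occurs in
-- every h_i(V(G_i)).

module Submission where

open import Defs
open import Data.Nat using (ℕ; zero; suc; _+_; _*_; _∸_; _≤_; s≤s; z≤n)
open import Data.Nat.Properties
  using (≤-trans; m≤m+n; +-∸-comm; n≤1+n; +-monoˡ-≤; +-cancelʳ-≤; *-monoʳ-≤; ∸-monoˡ-≤; *-distribˡ-+)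
open import Data.Nat.Tactic.RingSolver using (solve-∀)
open import Data.Fin using (Fin; zero; suc; inject₁; toℕ; _↑ˡ_; _↑ʳ_)
open import Data.Fin.Properties using (suc-injective; ↑ˡ-injective; ↑ʳ-injective; toℕ-inject₁)
open import Data.Vec.Functional using (_++_)
open import Data.Vec.Functional.Properties using (lookup-++ˡ; lookup-++ʳ)
open import Data.Bool using (Bool; not)
open import Data.Bool.Properties using (not-¬)
open import Data.Product using (Σ; _×_; _,_; proj₁; proj₂)
open import Data.Sum using (inj₁; inj₂)
open import Data.Empty using (⊥-elim)
open import Relation.Binary.PropositionalEquality
  using (_≡_; _≢_; refl; sym; trans; cong; subst; subst₂; module ≡-Reasoning)
open ≡-Reasoning

data Split (m n : ℕ) : Fin (m + n) → Set where
  old : (i : Fin m) → Split m n (i ↑ˡ n)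
  new : (j : Fin n) → Split m n (m ↑ʳ j)

split : ∀ m n (e : Fin (m + n)) → Split m n e
split zero    n e       = new e
split (suc m) n zero    = old zero
split (suc m) n (suc e) with split m n e
... | old i = old (suc i)
... | new j = new j

↑ˡ≢↑ʳ : ∀ {m n} (i : Fin m) (j : Fin n) → i ↑ˡ n ≢ m ↑ʳ j
↑ˡ≢↑ʳ zero    j ()
↑ˡ≢↑ʳ (suc i) j eq = ↑ˡ≢↑ʳ i j (suc-injective eq)

SameEdge-map : ∀ {m n} (g : Fin m → Fin n) {a b c d : Fin m} →
  SameEdge (a , b) (c , d) → SameEdge (g a , g b) (g c , g d)
SameEdge-map g (inj₁ (a≡c , b≡d)) = inj₁ (cong g a≡c , cong g b≡d)
SameEdge-map g (inj₂ (a≡d , b≡c)) = inj₂ (cong g a≡d , cong g b≡c)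

SameEdge-unmap : ∀ {m n} (g : Fin m → Fin n) → (∀ {x y} → g x ≡ g y → x ≡ y) →
  ∀ {a b c d : Fin m} → SameEdge (g a , g b) (g c , g d) → SameEdge (a , b) (c , d)
SameEdge-unmap g inj (inj₁ (a≡c , b≡d)) = inj₁ (inj a≡c , inj b≡d)
SameEdge-unmap g inj (inj₂ (a≡d , b≡c)) = inj₂ (inj a≡d , inj b≡c)

Adjacent-sym : ∀ {G u v} → Adjacent G u v → Adjacent G v u
Adjacent-sym (e , inj₁ (a≡u , b≡v)) = e , inj₂ (a≡u , b≡v)
Adjacent-sym (e , inj₂ (a≡v , b≡u)) = e , inj₁ (a≡v , b≡u)

Reach-trans : ∀ {G u v w} → Reach G u v → Reach G v w → Reach G u w
Reach-trans r here       = r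
Reach-trans r (step s a) = step (Reach-trans r s) a

Reach-sym : ∀ {G u v} → Reach G u v → Reach G v u
Reach-sym here       = here
Reach-sym (step r a) = Reach-trans (step here (Adjacent-sym a)) (Reach-sym r)

module _ (G : Graph) (a : ℕ) (f : Fin a → Fin (p G)) where

  private
    H : Graph
    H = addLeaves G a f

  -- By definition, ends H is the concatenation (Data.Vec.Functional._++_) of the old and new edges.
  ends-old : ∀ e → ends H (e ↑ˡ a) ≡ (proj₁ (ends G e) ↑ˡ a , proj₂ (ends G e) ↑ˡ a)
  ends-old e = lookup-++ˡ {m = q G} _ _ e

  ends-new : ∀ j → ends H (q G ↑ʳ j) ≡ (f j ↑ˡ a , p G ↑ʳ j)
  ends-new j = lookup-++ʳ {m = q G} _ _ j

  addLeaves-simple : Simple G → Simple H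
  addLeaves-simple (loopless , edge-unique) = loopless′ , edge-unique′
    where
    loopless′ : ∀ e → proj₁ (ends H e) ≢ proj₂ (ends H e)
    loopless′ e with split (q G) a e
    ... | old i rewrite ends-old i = λ eq → loopless i (↑ˡ-injective a _ _ eq)
    ... | new j rewrite ends-new j = ↑ˡ≢↑ʳ (f j) j

    edge-unique′ : ∀ e e′ → SameEdge (ends H e) (ends H e′) → e ≡ e′
    edge-unique′ e e′ with split (q G) a e | split (q G) a e′
    ... | old i | old i′ rewrite ends-old i | ends-old i′ =
      λ s → cong (_↑ˡ a) (edge-unique i i′ (SameEdge-unmap (_↑ˡ a) (↑ˡ-injective a _ _) s))
    ... | old i | new j′ rewrite ends-old i | ends-new j′ = λ
      { (inj₁ (_ , b≡)) → ⊥-elim (↑ˡ≢↑ʳ _ j′ b≡)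
      ; (inj₂ (a≡ , _)) → ⊥-elim (↑ˡ≢↑ʳ _ j′ a≡) }
    ... | new j | old i′ rewrite ends-new j | ends-old i′ = λ
      { (inj₁ (_ , b≡)) → ⊥-elim (↑ˡ≢↑ʳ _ j (sym b≡))
      ; (inj₂ (_ , b≡)) → ⊥-elim (↑ˡ≢↑ʳ _ j (sym b≡)) }
    ... | new j | new j′ rewrite ends-new j | ends-new j′ = λ
      { (inj₁ (_ , b≡)) → cong (q G ↑ʳ_) (↑ʳ-injective (p G) j j′ b≡)
      ; (inj₂ (a≡ , _)) → ⊥-elim (↑ˡ≢↑ʳ _ j′ a≡) }

  Adjacent-old : ∀ {u v} → Adjacent G u v → Adjacent H (u ↑ˡ a) (v ↑ˡ a)
  Adjacent-old {u} {v} (e , s) =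
    e ↑ˡ a , subst (λ z → SameEdge z (u ↑ˡ a , v ↑ˡ a)) (sym (ends-old e)) (SameEdge-map (_↑ˡ a) s)

  Adjacent-new : ∀ j → Adjacent H (f j ↑ˡ a) (p G ↑ʳ j)
  Adjacent-new j =
    q G ↑ʳ j , subst (λ z → SameEdge z (f j ↑ˡ a , p G ↑ʳ j)) (sym (ends-new j)) (inj₁ (refl , refl))

  Reach-old : ∀ {u v} → Reach G u v → Reach H (u ↑ˡ a) (v ↑ˡ a)
  Reach-old here       = here
  Reach-old (step r e) = step (Reach-old r) (Adjacent-old e)

  attachment : Fin (p H) → Fin (p G)
  attachment v with split (p G) a v
  ... | old u = u
  ... | new j = f j

  Reach-attachment : ∀ v → Reach H (attachment v ↑ˡ a) v
  Reach-attachment v with split (p G) a v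
  ... | old u = here
  ... | new j = step here (Adjacent-new j)

  addLeaves-connected : Connected G → Connected H
  addLeaves-connected C u v = Reach-trans (Reach-sym (Reach-attachment u))
    (Reach-trans (Reach-old (C (attachment u) (attachment v))) (Reach-attachment v))

  addLeaves-bipartite : Bipartite G → Bipartite H
  addLeaves-bipartite (c , proper) = c′ , proper′
    where
    c′ : Fin (p H) → Bool
    c′ = c ++ (λ j → not (c (f j)))

    c′-old : ∀ v → c′ (v ↑ˡ a) ≡ c v
    c′-old = lookup-++ˡ c _

    c′-new : ∀ j → c′ (p G ↑ʳ j) ≡ not (c (f j))
    c′-new = lookup-++ʳ c _

    proper′ : ∀ e → c′ (proj₁ (ends H e)) ≢ c′ (proj₂ (ends H e))
    proper′ e with split (q G) a e
    ... | old i rewrite ends-old i | c′-old (proj₁ (ends G i)) | c′-old (proj₂ (ends G i)) = proper i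
    ... | new j rewrite ends-new j | c′-old (f j) | c′-new j = not-¬ refl

topColour : ℕ → ℕ
topColour q = 2 * q ∸ 1

topColour-mono : ∀ q → topColour q ≤ topColour (q + 1)
topColour-mono q = ∸-monoˡ-≤ 1 (*-monoʳ-≤ 2 (m≤m+n q 1))

topColour-+1 : ∀ {q} → 1 ≤ q → topColour (q + 1) ≡ topColour q + 2
topColour-+1 {q} 1≤q = begin
  2 * (q + 1) ∸ 1  ≡⟨ cong (_∸ 1) (*-distribˡ-+ 2 q 1) ⟩
  2 * q + 2 ∸ 1    ≡⟨ +-∸-comm {2 * q} 2 {1} (≤-trans (n≤1+n 1) (*-monoʳ-≤ 2 1≤q)) ⟩
  2 * q ∸ 1 + 2    ∎

1≤topColour : ∀ {q} → 1 ≤ q → 1 ≤ topColour q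
1≤topColour 1≤q = ∸-monoˡ-≤ 1 (*-monoʳ-≤ 2 1≤q)

odd-suc-+2 : ∀ t → suc (2 * t) + 2 ≡ suc (2 * suc t)
odd-suc-+2 = solve-∀

Odd-+2 : ∀ {m} → Odd m → Odd (m + 2)
Odd-+2 (t , refl) = suc t , odd-suc-+2 t

module LeafAtColourOne (G : Graph) (h : OEEMTC G) where

  private
    edge₁ : Σ (Fin (q G)) λ e → he h e ≡ 1
    edge₁ = he-onto h 1 (0 , refl) (1≤topColour (q≥1 h))

    e₁ : Fin (q G)
    e₁ = proj₁ edge₁

    y : Fin (p G)
    y = proj₂ (ends G e₁)

    k : ℕ
    k = proj₁ (magic h)

  x : Fin (p G)
  x = proj₁ (ends G e₁)

  private
    H : Graph
    H = addLeaves G 1 (λ _ → x)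

    hv′ : Fin (p G + 1) → ℕ
    hv′ = hv h ++ (λ _ → hv h y + 2)

    he′ : Fin (q G + 1) → ℕ
    he′ = (λ e → he h e + 2) ++ (λ _ → 1)

    hv′-old : ∀ v → hv′ (v ↑ˡ 1) ≡ hv h v
    hv′-old = lookup-++ˡ (hv h) _

    hv′-new : ∀ j → hv′ (p G ↑ʳ j) ≡ hv h y + 2
    hv′-new = lookup-++ʳ (hv h) _

    he′-old : ∀ e → he′ (e ↑ˡ 1) ≡ he h e + 2
    he′-old = lookup-++ˡ (λ e → he h e + 2) _

    he′-new : ∀ j → he′ (q G ↑ʳ j) ≡ 1
    he′-new = lookup-++ʳ (λ e → he h e + 2) _

    hv′-range : ∀ v → hv′ v ≤ topColour (q G + 1)
    hv′-range v with split (p G) 1 v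
    ... | old u rewrite hv′-old u = ≤-trans (hv-rng h u) (topColour-mono (q G))
    ... | new j rewrite hv′-new j | topColour-+1 (q≥1 h) =
      +-monoˡ-≤ 2 (hv-rng h y)

    he′-odd : ∀ e → Odd (he′ e) × he′ e ≤ topColour (q G + 1)
    he′-odd e with split (q G) 1 e
    ... | old i rewrite he′-old i | topColour-+1 (q≥1 h) =
      Odd-+2 (proj₁ (he-odd h i)) , +-monoˡ-≤ 2 (proj₂ (he-odd h i))
    ... | new j rewrite he′-new j =
      (0 , refl) , 1≤topColour (≤-trans (q≥1 h) (m≤m+n (q G) 1))

    he′-onto : ∀ m → Odd m → m ≤ topColour (q G + 1) → Σ (Fin (q G + 1)) λ e → he′ e ≡ m
    he′-onto _ (zero , refl) _ = q G ↑ʳ zero , he′-new zero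
    he′-onto _ (suc t , refl) m≤top
      with he-onto h (suc (2 * t)) (t , refl) (+-cancelʳ-≤ 2 _ _ m≤top′)
      where
      m≤top′ : suc (2 * t) + 2 ≤ topColour (q G) + 2
      m≤top′ = subst₂ _≤_ (sym (odd-suc-+2 t)) (topColour-+1 (q≥1 h)) m≤top
    ... | e , he≡ = e ↑ˡ 1 , trans (he′-old e) (trans (cong (_+ 2) he≡) (odd-suc-+2 t))

    shift-middle : ∀ a b c → a + (b + 2) + c ≡ a + b + c + 2
    shift-middle = solve-∀

    shift-right : ∀ a b c → a + b + (c + 2) ≡ a + b + c + 2
    shift-right = solve-∀

    magic′ : ∀ e → hv′ (proj₁ (ends H e)) + he′ e + hv′ (proj₂ (ends H e)) ≡ k + 2
    magic′ e with split (q G) 1 e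
    ... | old i rewrite ends-old G 1 (λ _ → x) i | he′-old i
                      | hv′-old (proj₁ (ends G i)) | hv′-old (proj₂ (ends G i)) =
      trans (shift-middle (hv h (proj₁ (ends G i))) (he h i) (hv h (proj₂ (ends G i))))
            (cong (_+ 2) (proj₂ (proj₂ (magic h)) i))
    ... | new j rewrite ends-new G 1 (λ _ → x) j | hv′-old x | hv′-new j | he′-new j =
      trans (shift-right (hv h x) 1 (hv h y))
        (cong (_+ 2) (subst (λ c → hv h x + c + hv h y ≡ k) (proj₂ edge₁) (proj₂ (proj₂ (magic h)) e₁)))

  extend : OEEMTC H
  extend = record
    { q≥1     = ≤-trans (q≥1 h) (m≤m+n (q G) 1)
    ; hv      = hv′
    ; he      = he′
    ; hv-rng  = hv′-range
    ; he-odd  = he′-odd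
    ; he-onto = he′-onto
    ; magic   = k + 2 , ≤-trans (proj₁ (proj₂ (magic h))) (m≤m+n k 2) , magic′
    }

  extend-old : ∀ v → hv extend (v ↑ˡ 1) ≡ hv h v
  extend-old = hv′-old

record Stage (c : ℕ) : Set where
  field
    graph       : Graph
    isSimple    : Simple graph
    isConnected : Connected graph
    isBipartite : Bipartite graph
    colouring   : OEEMTC graph
    witness     : Σ (Fin (p graph)) λ v → hv colouring v ≡ c

open Stage

grow : ∀ {c} → Stage c → Stage c
grow S = record
  { graph       = addLeaves (graph S) 1 (λ _ → x)
  ; isSimple    = addLeaves-simple (graph S) 1 _ (isSimple S)
  ; isConnected = addLeaves-connected (graph S) 1 _ (isConnected S)
  ; isBipartite = addLeaves-bipartite (graph S) 1 _ (isBipartite S)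
  ; colouring   = extend
  ; witness     = proj₁ (witness S) ↑ˡ 1 , trans (extend-old _) (proj₂ (witness S))
  }
  where open LeafAtColourOne (graph S) (colouring S)

grow-addsLeaves : ∀ {c} (S : Stage c) → AddsLeaves (graph S) (graph (grow S))
grow-addsLeaves S = 1 , s≤s z≤n , _ , refl

stage : ∀ {c} → Stage c → ℕ → Stage c
stage S zero    = S
stage S (suc m) = grow (stage S m)

mainTheorem5 : (G0 : Graph) → Simple G0 → Connected G0 → Bipartite G0 →
    (h0 : OEEMTC G0) → (n : ℕ) → 1 ≤ n →
    Σ (Fin n → Graph) λ Gs → Σ ((k : Fin n) → OEEMTC (Gs k)) λ hs →
      (∀ k → Simple (Gs k) × Connected (Gs k) × Bipartite (Gs k)) ×
      (∀ k → AddsLeaves (seqG G0 Gs (inject₁ k)) (Gs k)) ×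
      (∀ (i j : Fin (suc n)) → Σ ℕ λ m → VColor G0 h0 Gs hs i m × VColor G0 h0 Gs hs j m)
mainTheorem5 G0 simple connected bipartite h0 n _ =
  Gs , hs , (λ k → isSimple (S k) , isConnected (S k) , isBipartite (S k)) , adds , common
  where
  open LeafAtColourOne G0 h0 using (x)

  S₀ : Stage (hv h0 x)
  S₀ = record { graph = G0 ; isSimple = simple ; isConnected = connected
              ; isBipartite = bipartite ; colouring = h0 ; witness = x , refl }

  S : Fin n → Stage (hv h0 x)
  S k = stage S₀ (suc (toℕ k))

  Gs : Fin n → Graph
  Gs k = graph (S k)

  hs : (k : Fin n) → OEEMTC (Gs k)
  hs k = colouring (S k)

  previous : ∀ k → seqG G0 Gs (inject₁ k) ≡ graph (stage S₀ (toℕ k))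
  previous zero    = refl
  previous (suc k) = cong (λ m → graph (stage S₀ (suc m))) (toℕ-inject₁ k)

  adds : ∀ k → AddsLeaves (seqG G0 Gs (inject₁ k)) (Gs k)
  adds k rewrite previous k = grow-addsLeaves (stage S₀ (toℕ k))

  coloured : ∀ i → VColor G0 h0 Gs hs i (hv h0 x)
  coloured zero    = x , refl
  coloured (suc k) = witness (S k)

  common : ∀ i j → Σ ℕ λ m → VColor G0 h0 Gs hs i m × VColor G0 h0 Gs hs j m
  common i j = hv h0 x , coloured i , coloured j
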